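{- Let $(\mathbf{d^+},\mathbf{d^- })$ be a bi-degree sequence on vertices $v_1,\dots,v_n$, and let $A$ and $C$ be two $d^+_n$-element subsets of $\{v_1,\dots,v_{n-1}\}$ such that $C$ is to the left of $A$. Assume the vertices of $A\cup C$ are in normal order, i.e. whenever $v_a,v_b\in A\cup C$ with $a<b$, either $d^-_a>d^-_b$, or $d^-_a=d^-_b$ and $d^+_a\ge d^+_b$. If the $A$-reduced bi-degree sequence $(\mathbf{d^+}|_A,\mathbf{d^- }|_A)$ is bi-graphical, then so is the $C$-reduced bi-degree sequence $(\mathbf{d^+}|_C,\mathbf{d^- }|_C)$.
   Context: A bi-degree sequence is a pair of sequences $(\{d^+_1,\dots,d^+_n\},\{d^-_1,\dots,d^-_n\})$ of nonnegative integers; it is bi-graphical if there is a simple directed graph on $v_1,\dots,v_n$ (no loops, no parallel edges in the same direction; opposite edges $uv$, $vu$ allowed) where $v_j$ has out-degree $d^+_j$ and in-degree $d^-_j$; sequences with a negative entry are not bi-graphical. For a $d^+_n$-element subset $A\subseteq\{v_1,\dots,v_{n-1}\}$, the $A$-reduced sequence is defined by $d^+_k|_A=d^+_k$ for $k\ne n$, $d^+_n|_A=0$, and $d^-_k|_A=d^-_k-1$ if $v_k\in A$, $d^-_k|_A=d^-_k$ otherwise; any index $k$ with $d^+_k|_A=d^-_k|_A=0$ is removed. For a set $S$ of vertices let $\mathbf{i}(S)$ be the increasing vector of subscripts of its elements. For two sets $C,A$ of equal size $m$, $C$ is to the left of $A$ if $\mathbf{i}(C)_j\le\mathbf{i}(A)_j$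 for every $j=1,\dots,m$. -}

module Defs where

open import Data.Bool using (Bool; true; false; if_then_else_; not; _∧_)
open import Data.Nat as ℕ using (ℕ; zero; suc)
open import Data.Integer as ℤ using (ℤ; +_; _-_)
open import Data.Fin using (Fin; zero; suc; inject₁) renaming (_≤_ to _≤ᶠ_)
open import Data.Fin.Subset using (Subset; Side; inside; outside; _∈_; _∪_; ∣_∣)
open import Data.Vec using (Vec; []; _∷_)
open import Data.List using (List; []; _∷_; length; filterᵇ; allFin; map; lookup)
open import Data.List.Relation.Binary.Pointwise using (Pointwise)
open import Data.Product using (_×_; _,_; proj₁; proj₂; ∃)
open import Data.Sum using (_⊎_)
open import Relation.Binary.PropositionalEquality using (_≡_)

-- A (general, possibly with negative entries) bi-degree sequence:
-- a list of (out-degree , in-degree) pairs, vertex j being the j-th entry.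
BiSeq : Set
BiSeq = List (ℤ × ℤ)

-- A simple directed graph on Fin m: E i j = true iff there is an edge i → j.
-- (At most one edge per ordered pair; opposite edges allowed.)
Digraph : ℕ → Set
Digraph m = Fin m → Fin m → Bool

outdeg : ∀ {m} → Digraph m → Fin m → ℕ
outdeg {m} E j = length (filterᵇ (E j) (allFin m))

indeg : ∀ {m} → Digraph m → Fin m → ℕ
indeg {m} E j = length (filterᵇ (λ i → E i j) (allFin m))

Loopless : ∀ {m} → Digraph m → Set
Loopless E = ∀ j → E j j ≡ false

-- Bi-graphical: realized by a simple digraph (negative entries are
-- automatically not realizable since degrees are natural numbers).
BiGraphical : BiSeq → Set
BiGraphical s = ∃ λ (E : Digraph (length s)) → Loopless E ×
  (∀ j → + outdeg E j ≡ proj₁ (lookup s j) × + indeg E j ≡ proj₂ (lookup s j))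

isLast : ∀ {n} → Fin (suc n) → Bool
isLast {zero} zero = true
isLast {suc n} zero = false
isLast {suc n} (suc k) = isLast k

-- Membership of a vertex of Fin (suc n) in a subset of the first n vertices
-- {v_1,…,v_{n-1}} (the last vertex is never a member).
memb : ∀ {n} → Subset n → Fin (suc n) → Bool
memb [] zero = false
memb (inside ∷ S) zero = true
memb (outside ∷ S) zero = false
memb (_ ∷ S) (suc k) = memb S k

isZeroPair : ℤ × ℤ → Bool
isZeroPair (+ zero , + zero) = true
isZeroPair _ = false

reduced : ∀ {n} → (Fin (suc n) → ℕ) → (Fin (suc n) → ℕ) → Subset n → BiSeq
reduced {n} d⁺ d⁻ A =
  filterᵇ (λ p → not (isZeroPair p))
    (map (λ k → (if isLast k then + 0 else + d⁺ k)
              , (if memb A k then + d⁻ k - + 1 else + d⁻ k))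
         (allFin (suc n)))

idx : ∀ {n} → Subset n → List (Fin n)
idx [] = []
idx (inside ∷ S) = zero ∷ map suc (idx S)
idx (outside ∷ S) = map suc (idx S)

LeftOf : ∀ {n} → Subset n → Subset n → Set
LeftOf C A = ∣ C ∣ ≡ ∣ A ∣ × Pointwise _≤ᶠ_ (idx C) (idx A)

NormalOrder : ∀ {n} → (Fin (suc n) → ℕ) → (Fin (suc n) → ℕ) → Subset n → Set
NormalOrder {n} d⁺ d⁻ S = ∀ (a b : Fin n) → a ∈ S → b ∈ S → a Data.Fin.< b →
  (d⁻ (inject₁ b) ℕ.< d⁻ (inject₁ a))
  ⊎ (d⁻ (inject₁ a) ≡ d⁻ (inject₁ b) × d⁺ (inject₁ b) ℕ.≤ d⁺ (inject₁ a))

module Submission where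

-- Because C is to the left of A, the set A turns into C by a chain of
-- exchanges, each trading a member a for a non-member c < a; as both lie in
-- A ∪ C, c precedes a in normal order (exchanges-to-left).  An exchange moves
-- one unit of in-degree demand of the reduced sequence from c to a, and the
-- switching lemma (in-degree-shift) moves it in a realization: either some
-- in-neighbour w of c misses a and w → c is redirected to w → a, or the order
-- hypothesis forces a → c, c ↛ a and an out-neighbour z of c missed by a, and
-- a → c, c → z are replaced by c → a, a → z.  The list-based BiGraphical of a
-- reduced sequence (whose (0,0) entries are deleted) is equivalent to
-- realizability of the full sequence, (0,0) entries being isolated vertices.

open import Defs
open import Data.Bool using (Bool; true; false; if_then_else_; not; _∧_)
open import Data.Bool.Properties using (∧-zeroʳ; ∧-identityʳ) renaming (_≟_ to _≟ᵇ_)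
open import Data.Nat as ℕ using (ℕ; zero; suc; _+_; _≤_; _<_; z≤n; s≤s)
open import Data.Nat.Properties
  using (≤-refl; ≤-trans; ≤-reflexive; <⇒≤; <⇒≱; +-assoc; +-comm; +-identityʳ; +-mono-≤;
         +-commutativeSemigroup)
open import Algebra.Properties.CommutativeSemigroup +-commutativeSemigroup using (x∙yz≈y∙xz)
open import Data.Integer as ℤ using (ℤ; +_; -[1+_])
open import Data.Integer.Properties using (+-injective)
open import Data.Fin using (Fin; zero; suc; fromℕ; inject₁; cast)
  renaming (_≤_ to _≤ᶠ_; _<_ to _<ᶠ_)
open import Data.Fin.Properties using (_≟_; any?; inject₁-injective; cast-is-id; cast-involutive)
open import Data.Fin.Subset using (Subset; Side; inside; outside; _∈_; _∪_; _⊆_; ∣_∣)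
open import Data.Fin.Subset.Properties using (p⊆p∪q; q⊆p∪q; x∈p∪q⁻)
open import Data.Vec as Vec using ([]; _∷_; here; there)
open import Data.Vec.Properties using (lookup⇒[]=)
open import Data.List
  using (List; []; _∷_; [_]; _++_; length; filterᵇ; allFin; tabulate; map; lookup)
open import Data.List.Properties using (++-assoc; length-tabulate; lookup-tabulate; map-tabulate)
open import Data.List.Relation.Binary.Pointwise as Pointwise using (Pointwise; []; _∷_)
open import Data.Maybe as Maybe using (Maybe; just; nothing)
open import Data.Product using (_×_; _,_; proj₁; proj₂; ∃; map₂)
open import Data.Sum using (_⊎_; inj₁; inj₂; [_,_]′)
open import Data.Empty using (⊥-elim)
open import Function using (_∘_; id; _⇔_; mk⇔; Equivalence)
import Function.Properties.Equivalence as ⇔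
open import Relation.Nullary using (¬_; Dec; yes; no; does)
open import Relation.Nullary.Decidable using (_×-dec_; ¬?)
open import Relation.Binary.PropositionalEquality hiding ([_])

bit : Bool → ℕ
bit true  = 1
bit false = 0

count : ∀ {m} → (Fin m → Bool) → ℕ
count {zero}  f = 0
count {suc m} f = bit (f zero) + count (f ∘ suc)

count-filter : ∀ {A : Set} {m} (p : A → Bool) (f : Fin m → A) →
  length (filterᵇ p (tabulate f)) ≡ count (p ∘ f)
count-filter {m = zero}  p f = refl
count-filter {m = suc m} p f with p (f zero)
... | true  = cong suc (count-filter p (f ∘ suc))
... | false = count-filter p (f ∘ suc)

count-ext : ∀ {m} {f g : Fin m → Bool} → (∀ x → f x ≡ g x) → count f ≡ count g
count-ext {zero}  f≗g = refl
count-ext {suc m} f≗g = cong₂ _+_ (cong bit (f≗g zero)) (count-ext (f≗g ∘ suc))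

count-mono : ∀ {m} {f g : Fin m → Bool} →
  (∀ x → f x ≡ true → g x ≡ true) → count f ≤ count g
count-mono {zero}  f⊆g = z≤n
count-mono {suc m} {f} {g} f⊆g = +-mono-≤ head (count-mono (f⊆g ∘ suc))
  where
  head : bit (f zero) ≤ bit (g zero)
  head with f zero | f⊆g zero
  ... | false | _ = z≤n
  ... | true  | g0 rewrite g0 refl = ≤-refl

count≡0⇒false : ∀ {m} {f : Fin m → Bool} → count f ≡ 0 → ∀ x → f x ≡ false
count≡0⇒false {suc m} {f} eq x with f zero in f0
count≡0⇒false {suc m} {f} eq zero    | false = f0
count≡0⇒false {suc m} {f} eq (suc x) | false = count≡0⇒false eq x

false⇒count≡0 : ∀ {m} {f : Fin m → Bool} → (∀ x → f x ≡ false) → count f ≡ 0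
false⇒count≡0 {zero}      never = refl
false⇒count≡0 {suc m} {f} never rewrite never zero = false⇒count≡0 (never ∘ suc)

_∖_ : ∀ {m} → (Fin m → Bool) → Fin m → Fin m → Bool
(f ∖ p) x = f x ∧ not (does (x ≟ p))

∖-true : ∀ {m} {f : Fin m → Bool} {p x} → (f ∖ p) x ≡ true → f x ≡ true × x ≢ p
∖-true {f = f} {p} {x} fx with f x | x ≟ p
... | true | no x≢p = refl , x≢p

∖-intro : ∀ {m} {f : Fin m → Bool} {p x} → f x ≡ true → x ≢ p → (f ∖ p) x ≡ true
∖-intro {p = p} {x} fx x≢p with x ≟ p
... | yes x≡p = ⊥-elim (x≢p x≡p)
... | no _    rewrite fx = refl

∖-agree : ∀ {m} {f g : Fin m → Bool} (p : Fin m) →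
  (∀ x → x ≢ p → f x ≡ g x) → ∀ x → (f ∖ p) x ≡ (g ∖ p) x
∖-agree {f = f} {g} p agree x with x ≟ p
... | yes _   = trans (∧-zeroʳ (f x)) (sym (∧-zeroʳ (g x)))
... | no x≢p  = cong (_∧ true) (agree x x≢p)

count-split : ∀ {m} (f : Fin m → Bool) (p : Fin m) → count f ≡ count (f ∖ p) + bit (f p)
count-split {suc m} f zero rewrite ∧-zeroʳ (f zero) =
  trans (+-comm (bit (f zero)) _)
        (cong (λ k → k + bit (f zero)) (count-ext (λ x → sym (∧-identityʳ (f (suc x))))))
count-split {suc m} f (suc p) rewrite ∧-identityʳ (f zero) =
  trans (cong (λ k → bit (f zero) + k) (count-split (f ∘ suc) p))
        (sym (+-assoc (bit (f zero)) _ _))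

count-split-true : ∀ {m} {f : Fin m → Bool} (p : Fin m) → f p ≡ true →
  count f ≡ suc (count (f ∖ p))
count-split-true {f = f} p fp =
  trans (count-split f p) (trans (cong (λ b → count (f ∖ p) + bit b) fp) (+-comm _ 1))

count-split-false : ∀ {m} {f : Fin m → Bool} (p : Fin m) → f p ≡ false →
  count f ≡ count (f ∖ p)
count-split-false {f = f} p fp =
  trans (count-split f p) (trans (cong (λ b → count (f ∖ p) + bit b) fp) (+-identityʳ _))

count-point : ∀ {m} {f g : Fin m → Bool} (p : Fin m) → f p ≡ true → g p ≡ false →
  (∀ x → x ≢ p → f x ≡ g x) → count f ≡ suc (count g)
count-point p fp gp agree =
  trans (count-split-true p fp)
        (cong suc (trans (count-ext (∖-agree p agree)) (sym (count-split-false p gp))))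

count-move : ∀ {m} {f g : Fin m → Bool} (p q : Fin m) →
  f p ≡ true → f q ≡ false → g p ≡ false → g q ≡ true →
  (∀ x → x ≢ p → x ≢ q → f x ≡ g x) → count f ≡ count g
count-move {f = f} {g} p q fp fq gp gq agree =
  trans (count-point p fp (false-right gp) meet-left)
        (sym (count-point q gq (false-left fq) meet-right))
  where
  -- both f and g are counted through their meet f ∧ g, which is f without p
  -- and g without q
  false-right : ∀ {x y} → y ≡ false → x ∧ y ≡ false
  false-right {x} refl = ∧-zeroʳ x
  false-left : ∀ {x y} → x ≡ false → x ∧ y ≡ false
  false-left refl = refl
  idem : ∀ b → b ≡ b ∧ b
  idem true  = refl
  idem false = refl
  meet-left : ∀ x → x ≢ p → f x ≡ f x ∧ g x
  meet-left x x≢p with x ≟ q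
  ... | yes refl rewrite fq = refl
  ... | no x≢q   rewrite agree x x≢p x≢q = idem (g x)
  meet-right : ∀ x → x ≢ q → g x ≡ f x ∧ g x
  meet-right x x≢q with x ≟ p
  ... | yes refl rewrite gp = sym (∧-zeroʳ (f p))
  ... | no x≢p   rewrite agree x x≢p x≢q = idem (g x)

count-strict : ∀ {m} {f g : Fin m → Bool} (p : Fin m) →
  (∀ x → f x ≡ true → g x ≡ true) → f p ≡ false → g p ≡ true → suc (count f) ≤ count g
count-strict {f = f} {g} p f⊆g fp gp =
  subst₂ _≤_ (cong suc (sym (count-split-false p fp))) (sym (count-split-true p gp))
    (s≤s (count-mono removed⊆))
  where
  removed⊆ : ∀ x → (f ∖ p) x ≡ true → (g ∖ p) x ≡ true
  removed⊆ x fx with ∖-true {f = f} fx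
  ... | fx' , x≢p = ∖-intro {f = g} (f⊆g x fx') x≢p

outDeg : ∀ {m} → Digraph m → Fin m → ℕ
outDeg E x = count (E x)

col : ∀ {m} → Digraph m → Fin m → Fin m → Bool
col E y x = E x y

inDeg : ∀ {m} → Digraph m → Fin m → ℕ
inDeg E y = count (col E y)

_[_,_≔_] : ∀ {m} → Digraph m → Fin m → Fin m → Bool → Digraph m
(E [ u , v ≔ b ]) x y = if does (x ≟ u) ∧ does (y ≟ v) then b else E x y

set-hit : ∀ {m} (E : Digraph m) u v b → (E [ u , v ≔ b ]) u v ≡ b
set-hit E u v b with u ≟ u | v ≟ v
... | yes _ | yes _  = refl
... | no u≢u | _     = ⊥-elim (u≢u refl)
... | yes _ | no v≢v = ⊥-elim (v≢v refl)

set-miss : ∀ {m} (E : Digraph m) {u v b} x y → ¬ (x ≡ u × y ≡ v) →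
  (E [ u , v ≔ b ]) x y ≡ E x y
set-miss E {u} {v} x y off with x ≟ u | y ≟ v
... | yes x≡u | yes y≡v = ⊥-elim (off (x≡u , y≡v))
... | yes _   | no _    = refl
... | no _    | _       = refl

off-row : ∀ {m} {x u y v : Fin m} → x ≢ u → ¬ (x ≡ u × y ≡ v)
off-row x≢u = x≢u ∘ proj₁

off-col : ∀ {m} {x u y v : Fin m} → y ≢ v → ¬ (x ≡ u × y ≡ v)
off-col y≢v = y≢v ∘ proj₂

distinct : ∀ {m} {x u v : Fin m} → u ≢ v → ¬ (x ≡ u × x ≡ v)
distinct u≢v (p , q) = u≢v (trans (sym p) q)

record InDegreeShift {m} (E E′ : Digraph m) (c a : Fin m) : Set where
  field
    loopless      : Loopless E′
    out-preserved : ∀ x → outDeg E′ x ≡ outDeg E x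
    in-source     : inDeg E c ≡ suc (inDeg E′ c)
    in-target     : inDeg E′ a ≡ suc (inDeg E a)
    in-others     : ∀ y → y ≢ c → y ≢ a → inDeg E′ y ≡ inDeg E y

module Redirect {m} (E : Digraph m) (loop : Loopless E) {c a w : Fin m}
                (w≢a : w ≢ a) (Ewc : E w c ≡ true) (Ewa : E w a ≡ false) where

  E₁ E′ : Digraph m
  E₁ = E [ w , c ≔ false ]
  E′ = E₁ [ w , a ≔ true ]

  unchanged : ∀ x y → ¬ (x ≡ w × y ≡ c) → ¬ (x ≡ w × y ≡ a) → E′ x y ≡ E x y
  unchanged x y off₁ off₂ = trans (set-miss E₁ x y off₂) (set-miss E x y off₁)

  w≢c : w ≢ c
  w≢c refl with trans (sym Ewc) (loop w)
  ... | ()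

  c≢a : c ≢ a
  c≢a refl with trans (sym Ewc) Ewa
  ... | ()

  E′wa : E′ w a ≡ true
  E′wa = set-hit E₁ w a true

  E′wc : E′ w c ≡ false
  E′wc = trans (set-miss E₁ w c (off-col c≢a)) (set-hit E w c false)

  shift : InDegreeShift E E′ c a
  shift = record
    { loopless      = λ x → trans (unchanged x x (distinct w≢c) (distinct w≢a)) (loop x)
    ; out-preserved = row
    ; in-source     = count-point w Ewc E′wc
                        (λ x x≢w → sym (unchanged x c (off-row x≢w) (off-row x≢w)))
    ; in-target     = count-point w E′wa Ewa
                        (λ x x≢w → unchanged x a (off-row x≢w) (off-row x≢w))
    ; in-others     = λ y y≢c y≢a →
                        count-ext (λ x → unchanged x y (off-col y≢c) (off-col y≢a))
    }
    where
    row : ∀ x → outDeg E′ x ≡ outDeg E x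
    row x = by-cases (x ≟ w)
      where
      by-cases : Dec (x ≡ w) → outDeg E′ x ≡ outDeg E x
      by-cases (yes refl) = count-move a c E′wa E′wc Ewa Ewc
                         (λ y y≢a y≢c → unchanged w y (off-col y≢c) (off-col y≢a))
      by-cases (no x≢w)   = count-ext (λ y → unchanged x y (off-row x≢w) (off-row x≢w))

module Reverse {m} (E : Digraph m) (loop : Loopless E) {c a z : Fin m} (c≢a : c ≢ a)
               (z≢c : z ≢ c) (z≢a : z ≢ a) (Eac : E a c ≡ true) (Eca : E c a ≡ false)
               (Ecz : E c z ≡ true) (Eaz : E a z ≡ false) where

  E₁ E₂ E₃ E′ : Digraph m
  E₁ = E [ a , c ≔ false ]
  E₂ = E₁ [ c , z ≔ false ]
  E₃ = E₂ [ c , a ≔ true ]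
  E′ = E₃ [ a , z ≔ true ]

  unchanged : ∀ x y → ¬ (x ≡ a × y ≡ c) → ¬ (x ≡ c × y ≡ z) →
              ¬ (x ≡ c × y ≡ a) → ¬ (x ≡ a × y ≡ z) → E′ x y ≡ E x y
  unchanged x y off₁ off₂ off₃ off₄ = trans (set-miss E₃ x y off₄)
    (trans (set-miss E₂ x y off₃) (trans (set-miss E₁ x y off₂) (set-miss E x y off₁)))

  a≢c : a ≢ c
  a≢c = c≢a ∘ sym

  E′az : E′ a z ≡ true
  E′az = set-hit E₃ a z true

  E′ca : E′ c a ≡ true
  E′ca = trans (set-miss E₃ c a (off-row c≢a)) (set-hit E₂ c a true)

  E′cz : E′ c z ≡ false
  E′cz = trans (set-miss E₃ c z (off-row c≢a))
           (trans (set-miss E₂ c z (off-col z≢a)) (set-hit E₁ c z false))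

  E′ac : E′ a c ≡ false
  E′ac = trans (set-miss E₃ a c (off-col (z≢c ∘ sym))) (trans (set-miss E₂ a c (off-row a≢c))
           (trans (set-miss E₁ a c (off-row a≢c)) (set-hit E a c false)))

  shift : InDegreeShift E E′ c a
  shift = record
    { loopless      = λ x → trans (unchanged x x (distinct a≢c) (distinct (z≢c ∘ sym))
                                             (distinct c≢a) (distinct (z≢a ∘ sym))) (loop x)
    ; out-preserved = row
    ; in-source     = count-point a Eac E′ac (λ x x≢a → sym (unchanged x c (off-row x≢a)
                        (off-col (z≢c ∘ sym)) (off-col c≢a) (off-row x≢a)))
    ; in-target     = count-point c E′ca Eca (λ x x≢c → unchanged x a (off-col a≢c)
                        (off-row x≢c) (off-row x≢c) (off-col (z≢a ∘ sym)))
    ; in-others     = other-column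
    }
    where
    row : ∀ x → outDeg E′ x ≡ outDeg E x
    row x = by-cases (x ≟ a) (x ≟ c)
      where
      by-cases : Dec (x ≡ a) → Dec (x ≡ c) → outDeg E′ x ≡ outDeg E x
      by-cases (yes refl) _ = count-move z c E′az E′ac Eaz Eac
          (λ y y≢z y≢c →
             unchanged a y (off-col y≢c) (off-row a≢c) (off-row a≢c) (off-col y≢z))
      by-cases (no _) (yes refl) = count-move a z E′ca E′cz Eca Ecz
          (λ y y≢a y≢z →
             unchanged c y (off-row c≢a) (off-col y≢z) (off-col y≢a) (off-row c≢a))
      by-cases (no x≢a) (no x≢c) = count-ext (λ y →
          unchanged x y (off-row x≢a) (off-row x≢c) (off-row x≢c) (off-row x≢a))
    other-column : ∀ y → y ≢ c → y ≢ a → inDeg E′ y ≡ inDeg E y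
    other-column y y≢c y≢a = by-cases (y ≟ z)
      where
      by-cases : Dec (y ≡ z) → inDeg E′ y ≡ inDeg E y
      by-cases (yes refl) = count-move a c E′az E′cz Eaz Ecz
          (λ x x≢a x≢c →
             unchanged x y (off-col y≢c) (off-row x≢c) (off-col y≢a) (off-row x≢a))
      by-cases (no y≢z) = count-ext (λ x →
          unchanged x y (off-col y≢c) (off-col y≢z) (off-col y≢a) (off-col y≢z))

Before : ℕ → ℕ → ℕ → ℕ → Set
Before i o i′ o′ = i′ < i ⊎ (i ≡ i′ × o′ ≤ o)

blocked : ∀ {m} (E : Digraph m) → Loopless E → {c a : Fin m} →
  Before (inDeg E c) (outDeg E c) (suc (inDeg E a)) (outDeg E a) →
  (∀ x → x ≢ a → E x c ≡ true → E x a ≡ true) →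
  E a c ≡ true × E c a ≡ false × outDeg E a ≤ outDeg E c
blocked E loop {c} {a} before covered = Eac , Eca , out-bound
  where
  others⊆ : ∀ x → (col E c ∖ a) x ≡ true → E x a ≡ true
  others⊆ x ox with ∖-true {f = col E c} ox
  ... | Exc , x≢a = covered x x≢a Exc
  bound : count (col E c ∖ a) ≤ inDeg E a
  bound = count-mono others⊆
  a<c : inDeg E a < inDeg E c
  a<c = [ <⇒≤ , (λ (eq , _) → ≤-reflexive (sym eq)) ]′ before
  Eac : E a c ≡ true
  Eac with E a c in e
  ... | true  = refl
  ... | false = ⊥-elim (<⇒≱ a<c (≤-trans (≤-reflexive (count-split-false a e)) bound))
  others-c : (col E c ∖ a) c ≡ false
  others-c rewrite loop c = refl
  Eca : E c a ≡ false
  Eca with E c a in e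
  ... | false = refl
  ... | true  = ⊥-elim (<⇒≱ a<c (≤-trans (≤-reflexive (count-split-true a Eac))
                                          (count-strict c others⊆ others-c e)))
  out-bound : outDeg E a ≤ outDeg E c
  out-bound = [ (λ lt → ⊥-elim (<⇒≱ lt c≤1+a)) , proj₂ ]′ before
    where
    c≤1+a : inDeg E c ≤ suc (inDeg E a)
    c≤1+a = ≤-trans (≤-reflexive (count-split-true a Eac)) (s≤s bound)

reverse-shift : ∀ {m} (E : Digraph m) → Loopless E → {c a : Fin m} → c ≢ a →
  E a c ≡ true × E c a ≡ false × outDeg E a ≤ outDeg E c →
  ∃ λ E′ → InDegreeShift E E′ c a
reverse-shift E loop {c} {a} c≢a (Eac , Eca , out≤)
  with any? (λ z → (E c z ≟ᵇ true) ×-dec (E a z ≟ᵇ false))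
... | yes (z , Ecz , Eaz) = _ , Reverse.shift E loop c≢a z≢c z≢a Eac Eca Ecz Eaz
  where
  z≢c : z ≢ c
  z≢c refl with trans (sym Ecz) (loop z)
  ... | ()
  z≢a : z ≢ a
  z≢a refl with trans (sym Ecz) Eca
  ... | ()
... | no none = ⊥-elim (<⇒≱ (count-strict c out-c⊆out-a (loop c) Eac) out≤)
  where
  out-c⊆out-a : ∀ x → E c x ≡ true → E a x ≡ true
  out-c⊆out-a x Ecx with E a x in e
  ... | true  = refl
  ... | false = ⊥-elim (none (x , Ecx , e))

in-degree-shift : ∀ {m} (E : Digraph m) → Loopless E → {c a : Fin m} → c ≢ a →
  Before (inDeg E c) (outDeg E c) (suc (inDeg E a)) (outDeg E a) →
  ∃ λ E′ → InDegreeShift E E′ c a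
in-degree-shift E loop {c} {a} c≢a before
  with any? (λ w → (E w c ≟ᵇ true) ×-dec (E w a ≟ᵇ false) ×-dec ¬? (w ≟ a))
... | yes (w , Ewc , Ewa , w≢a) = _ , Redirect.shift E loop w≢a Ewc Ewa
... | no none = reverse-shift E loop c≢a (blocked E loop before covered)
  where
  covered : ∀ x → x ≢ a → E x c ≡ true → E x a ≡ true
  covered x x≢a Exc with E x a in e
  ... | true  = refl
  ... | false = ⊥-elim (none (x , Exc , e , x≢a))

Realizes : ∀ {m} → Digraph m → (Fin m → ℤ × ℤ) → Set
Realizes E s = Loopless E × (∀ j → + outDeg E j ≡ proj₁ (s j) × + inDeg E j ≡ proj₂ (s j))

Realizable : ∀ {m} → (Fin m → ℤ × ℤ) → Set
Realizable s = ∃ λ E → Realizes E s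

record DemandShift {m} (s s′ : Fin m → ℤ × ℤ) (c a : Fin m) : Set where
  field
    out-c in-c out-a in-a : ℕ
    c≢a           : c ≢ a
    source-before : s c  ≡ (+ out-c , + in-c)
    source-after  : s′ c ≡ (+ out-c , + in-c ℤ.- + 1)
    target-before : s a  ≡ (+ out-a , + in-a ℤ.- + 1)
    target-after  : s′ a ≡ (+ out-a , + in-a)
    elsewhere     : ∀ k → k ≢ c → k ≢ a → s′ k ≡ s k

demand-minus-one : ∀ k i → + k ≡ + i ℤ.- + 1 → i ≡ suc k
demand-minus-one k zero    ()
demand-minus-one k (suc i) eq = cong suc (sym (+-injective eq))

shifted-degrees : ∀ {m} {s s′ : Fin m → ℤ × ℤ} {c a : Fin m} (σ : DemandShift s s′ c a)
  {E : Digraph m} → Realizes E s → let open DemandShift σ in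
  outDeg E c ≡ out-c × inDeg E c ≡ in-c × outDeg E a ≡ out-a × suc (inDeg E a) ≡ in-a
shifted-degrees {c = c} {a} σ (_ , deg) =
  +-injective (trans (proj₁ (deg c)) (cong proj₁ source-before)) ,
  +-injective (trans (proj₂ (deg c)) (cong proj₂ source-before)) ,
  +-injective (trans (proj₁ (deg a)) (cong proj₁ target-before)) ,
  sym (demand-minus-one _ in-a (trans (proj₂ (deg a)) (cong proj₂ target-before)))
  where open DemandShift σ

shift-realizes : ∀ {m} {s s′ : Fin m → ℤ × ℤ} {c a : Fin m} (σ : DemandShift s s′ c a)
  {E E′ : Digraph m} → Realizes E s → InDegreeShift E E′ c a → Realizes E′ s′
shift-realizes {s = s} {s′} {c} {a} σ {E} {E′} r@(_ , deg) shift =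
  loopless , λ j → out j , inn j
  where
  open DemandShift σ
  open InDegreeShift shift
  out : ∀ j → + outDeg E′ j ≡ proj₁ (s′ j)
  out j = trans (cong +_ (out-preserved j)) (trans (proj₁ (deg j)) (by-cases (j ≟ c) (j ≟ a)))
    where
    by-cases : Dec (j ≡ c) → Dec (j ≡ a) → proj₁ (s j) ≡ proj₁ (s′ j)
    by-cases (yes refl) _ = trans (cong proj₁ source-before) (sym (cong proj₁ source-after))
    by-cases (no _) (yes refl) = trans (cong proj₁ target-before) (sym (cong proj₁ target-after))
    by-cases (no j≢c) (no j≢a) = cong proj₁ (sym (elsewhere j j≢c j≢a))
  inn : ∀ j → + inDeg E′ j ≡ proj₂ (s′ j)
  inn j = by-cases (j ≟ c) (j ≟ a)
    where
    -- at c: in-c = 1 + inDeg E′ c, and + (1 + k) - 1 computes to + k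
    by-cases : Dec (j ≡ c) → Dec (j ≡ a) → + inDeg E′ j ≡ proj₂ (s′ j)
    by-cases (yes refl) _ = trans
      (cong (λ i → + i ℤ.- + 1) (trans (sym in-source) (proj₁ (proj₂ (shifted-degrees σ r)))))
      (sym (cong proj₂ source-after))
    by-cases (no _) (yes refl) = trans
      (cong +_ (trans in-target (proj₂ (proj₂ (proj₂ (shifted-degrees σ r))))))
      (sym (cong proj₂ target-after))
    by-cases (no j≢c) (no j≢a) = trans (cong +_ (in-others j j≢c j≢a))
      (trans (proj₂ (deg j)) (cong proj₂ (sym (elsewhere j j≢c j≢a))))

demand-shift : ∀ {m} {s s′ : Fin m → ℤ × ℤ} {c a : Fin m} (σ : DemandShift s s′ c a) →
  let open DemandShift σ in
  Before in-c out-c in-a out-a → Realizable s → Realizable s′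
demand-shift {c = c} {a} σ before (E , r@(loop , _)) =
  map₂ (shift-realizes σ r) (in-degree-shift E loop c≢a before-in-E)
  where
  open DemandShift σ
  before-in-E : Before (inDeg E c) (outDeg E c) (suc (inDeg E a)) (outDeg E a)
  before-in-E with shifted-degrees σ r
  ... | out-c≡ , in-c≡ , out-a≡ , in-a≡ rewrite out-c≡ | in-c≡ | out-a≡ | in-a≡ = before

graphical⇔realizable : ∀ l → BiGraphical l ⇔ Realizable (lookup l)
graphical⇔realizable l = mk⇔
  (λ (E , loop , deg) → E , loop , λ j →
     trans (cong +_ (sym (count-filter (E j) id))) (proj₁ (deg j)) ,
     trans (cong +_ (sym (count-filter (col E j) id))) (proj₂ (deg j)))
  (λ (E , loop , deg) → E , loop , λ j →
     trans (cong +_ (count-filter (E j) id)) (proj₁ (deg j)) ,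
     trans (cong +_ (count-filter (col E j) id)) (proj₂ (deg j)))

zeroPair : ℤ × ℤ
zeroPair = + 0 , + 0

-- An entry (0 , 0) of a list p ++ z ∷ l is an isolated vertex: deleting
-- or inserting it does not affect realizability.
module IsolatedVertex (z : ℤ × ℤ) (l : List (ℤ × ℤ)) where

  pos : ∀ p → Fin (length (p ++ z ∷ l))
  pos []      = zero
  pos (_ ∷ p) = suc (pos p)

  ins : ∀ p → Fin (length (p ++ l)) → Fin (length (p ++ z ∷ l))
  ins []      j       = suc j
  ins (_ ∷ p) zero    = zero
  ins (_ ∷ p) (suc j) = suc (ins p j)

  out : ∀ p → Fin (length (p ++ z ∷ l)) → Maybe (Fin (length (p ++ l)))
  out []      zero    = nothing
  out []      (suc j) = just j
  out (_ ∷ p) zero    = just zero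
  out (_ ∷ p) (suc u) = Maybe.map suc (out p u)

  lookup-ins : ∀ p j → lookup (p ++ z ∷ l) (ins p j) ≡ lookup (p ++ l) j
  lookup-ins []      j       = refl
  lookup-ins (_ ∷ p) zero    = refl
  lookup-ins (_ ∷ p) (suc j) = lookup-ins p j

  lookup-pos : ∀ p → lookup (p ++ z ∷ l) (pos p) ≡ z
  lookup-pos []      = refl
  lookup-pos (_ ∷ p) = lookup-pos p

  out-ins : ∀ p j → out p (ins p j) ≡ just j
  out-ins []      j       = refl
  out-ins (_ ∷ p) zero    = refl
  out-ins (_ ∷ p) (suc j) rewrite out-ins p j = refl

  out-pos : ∀ p → out p (pos p) ≡ nothing
  out-pos []      = refl
  out-pos (_ ∷ p) rewrite out-pos p = refl

  cover : ∀ p u → u ≡ pos p ⊎ ∃ λ j → u ≡ ins p j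
  cover []      zero    = inj₁ refl
  cover []      (suc u) = inj₂ (u , refl)
  cover (_ ∷ p) zero    = inj₂ (zero , refl)
  cover (_ ∷ p) (suc u) with cover p u
  ... | inj₁ e       = inj₁ (cong suc e)
  ... | inj₂ (j , e) = inj₂ (suc j , cong suc e)

  count-ins : ∀ p (f : Fin (length (p ++ z ∷ l)) → Bool) →
    count f ≡ bit (f (pos p)) + count (f ∘ ins p)
  count-ins []      f = refl
  count-ins (_ ∷ p) f =
    trans (cong (λ k → bit (f zero) + k) (count-ins p (f ∘ suc)))
          (x∙yz≈y∙xz (bit (f zero)) (bit (f (suc (pos p)))) (count (f ∘ suc ∘ ins p)))

  count-ins-false : ∀ p {f : Fin (length (p ++ z ∷ l)) → Bool} → f (pos p) ≡ false →
    count f ≡ count (f ∘ ins p)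
  count-ins-false p {f} fpos = trans (count-ins p f) (cong (λ b → bit b + count (f ∘ ins p)) fpos)

  delete : ∀ p → z ≡ zeroPair → Realizable (lookup (p ++ z ∷ l)) → Realizable (lookup (p ++ l))
  delete p refl (E , loop , deg) = E′ , (λ j → loop (ins p j)) , λ j → out-deg j , in-deg j
    where
    E′ : Digraph (length (p ++ l))
    E′ x y = E (ins p x) (ins p y)
    no-out : ∀ u → E (pos p) u ≡ false
    no-out = count≡0⇒false
      (+-injective (trans (proj₁ (deg (pos p))) (cong proj₁ (lookup-pos p))))
    no-in : ∀ u → E u (pos p) ≡ false
    no-in = count≡0⇒false
      (+-injective (trans (proj₂ (deg (pos p))) (cong proj₂ (lookup-pos p))))
    out-deg : ∀ j → + outDeg E′ j ≡ proj₁ (lookup (p ++ l) j)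
    out-deg j = trans (cong +_ (sym (count-ins-false p (no-in (ins p j)))))
                      (trans (proj₁ (deg (ins p j))) (cong proj₁ (lookup-ins p j)))
    in-deg : ∀ j → + inDeg E′ j ≡ proj₂ (lookup (p ++ l) j)
    in-deg j = trans (cong +_ (sym (count-ins-false p (no-out (ins p j)))))
                     (trans (proj₂ (deg (ins p j))) (cong proj₂ (lookup-ins p j)))

  liftEdge : ∀ {k} → Digraph k → Maybe (Fin k) → Maybe (Fin k) → Bool
  liftEdge E (just x) (just y) = E x y
  liftEdge E _        _        = false

  insert : ∀ p → z ≡ zeroPair → Realizable (lookup (p ++ l)) → Realizable (lookup (p ++ z ∷ l))
  insert p refl (E′ , loop , deg) = E , loopless , degrees
    where
    E : Digraph (length (p ++ z ∷ l))
    E x y = liftEdge E′ (out p x) (out p y)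
    no-out : ∀ u → E (pos p) u ≡ false
    no-out u rewrite out-pos p = refl
    no-in : ∀ u → E u (pos p) ≡ false
    no-in u rewrite out-pos p with out p u
    ... | just _  = refl
    ... | nothing = refl
    E-ins : ∀ x y → E (ins p x) (ins p y) ≡ E′ x y
    E-ins x y rewrite out-ins p x | out-ins p y = refl
    loopless : Loopless E
    loopless u with cover p u
    ... | inj₁ refl          = no-out (pos p)
    ... | inj₂ (j , refl) = trans (E-ins j j) (loop j)
    degrees : ∀ u → + outDeg E u ≡ proj₁ (lookup (p ++ z ∷ l) u)
                  × + inDeg E u ≡ proj₂ (lookup (p ++ z ∷ l) u)
    degrees u with cover p u
    ... | inj₁ refl =
      trans (cong +_ (false⇒count≡0 no-out)) (sym (cong proj₁ (lookup-pos p))) ,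
      trans (cong +_ (false⇒count≡0 no-in)) (sym (cong proj₂ (lookup-pos p)))
    ... | inj₂ (j , refl) =
      trans (cong +_ (trans (count-ins-false p (no-in (ins p j))) (count-ext (E-ins j))))
            (trans (proj₁ (deg j)) (sym (cong proj₁ (lookup-ins p j)))) ,
      trans (cong +_ (trans (count-ins-false p (no-out (ins p j))) (count-ext (λ x → E-ins x j))))
            (trans (proj₂ (deg j)) (sym (cong proj₂ (lookup-ins p j))))

nonzero : ℤ × ℤ → Bool
nonzero e = not (isZeroPair e)

nonzero-false : ∀ e → nonzero e ≡ false → e ≡ zeroPair
nonzero-false (+ zero , + zero) _ = refl
nonzero-false (+ zero , + suc _) ()
nonzero-false (+ zero , -[1+ _ ]) ()
nonzero-false (+ suc _ , _) ()
nonzero-false (-[1+ _ ] , _) ()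

realizable-≡ : ∀ {l l′ : List (ℤ × ℤ)} → l ≡ l′ →
  Realizable (lookup l) ⇔ Realizable (lookup l′)
realizable-≡ refl = ⇔.refl

remove-zeros : ∀ p l →
  Realizable (lookup (p ++ l)) ⇔ Realizable (lookup (p ++ filterᵇ nonzero l))
remove-zeros p []      = ⇔.refl
remove-zeros p (e ∷ l) with nonzero e in nz
... | true  = ⇔.trans (realizable-≡ (sym (++-assoc p [ e ] l)))
               (⇔.trans (remove-zeros (p ++ [ e ]) l)
                        (realizable-≡ (++-assoc p [ e ] (filterᵇ nonzero l))))
... | false = ⇔.trans (mk⇔ (delete p (nonzero-false e nz)) (insert p (nonzero-false e nz)))
                      (remove-zeros p l)
  where open IsolatedVertex e l

realizable-cast : ∀ {m m′} (eq : m ≡ m′) {s : Fin m → ℤ × ℤ} {s′ : Fin m′ → ℤ × ℤ} →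
  (∀ i → s′ (cast eq i) ≡ s i) → Realizable s → Realizable s′
realizable-cast refl {s} {s′} same (E , loop , deg) = E , loop , λ j →
  trans (proj₁ (deg j)) (cong proj₁ (s≡s′ j)) ,
  trans (proj₂ (deg j)) (cong proj₂ (s≡s′ j))
  where
  s≡s′ : ∀ j → s j ≡ s′ j
  s≡s′ j = sym (trans (cong s′ (sym (cast-is-id refl j))) (same j))

realizable-tabulate : ∀ {N} (F : Fin N → ℤ × ℤ) →
  Realizable (lookup (map F (allFin N))) ⇔ Realizable F
realizable-tabulate {N} F = ⇔.trans (realizable-≡ (map-tabulate id F)) (mk⇔
  (realizable-cast (length-tabulate F) (λ i → sym (lookup-cast i)))
  (realizable-cast (sym (length-tabulate F)) (lookup-tabulate F)))
  where
  lookup-cast : ∀ i → lookup (tabulate F) i ≡ F (cast (length-tabulate F) i)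
  lookup-cast i = trans (cong (lookup (tabulate F))
                               (sym (cast-involutive (sym (length-tabulate F)) (length-tabulate F) i)))
                        (lookup-tabulate F (cast (length-tabulate F) i))

record Exchange {n} (A B : Subset n) (c a : Fin n) : Set where
  field
    c∉A  : Vec.lookup A c ≡ outside
    a∈A  : Vec.lookup A a ≡ inside
    c∈B  : Vec.lookup B c ≡ inside
    a∉B  : Vec.lookup B a ≡ outside
    rest : ∀ k → k ≢ c → k ≢ a → Vec.lookup B k ≡ Vec.lookup A k

data Exchanges {n} (R : Fin n → Fin n → Set) : Subset n → Subset n → Set where
  done : ∀ {A} → Exchanges R A A
  step : ∀ {A B C c a} → Exchange A B c a → R c a → Exchanges R B C → Exchanges R A C

Ordered : ∀ {n} → (Fin n → Fin n → Set) → Subset n → Set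
Ordered R S = ∀ a b → a ∈ S → b ∈ S → a <ᶠ b → R a b

Tail : ∀ {n} → (Fin (suc n) → Fin (suc n) → Set) → Fin n → Fin n → Set
Tail R c a = R (suc c) (suc a)

exchanges-cons : ∀ {n} {R : Fin (suc n) → Fin (suc n) → Set} {A C : Subset n} (x : Side) →
  Exchanges (Tail R) A C → Exchanges R (x ∷ A) (x ∷ C)
exchanges-cons x done = done
exchanges-cons x (step ex r chain) = step exchange r (exchanges-cons x chain)
  where
  open Exchange ex
  exchange : Exchange _ _ _ _
  exchange = record
    { c∉A = c∉A ; a∈A = a∈A ; c∈B = c∈B ; a∉B = a∉B
    ; rest = λ { zero _ _ → refl
               ; (suc k) k≢c k≢a →
                   rest k (λ e → k≢c (cong suc e)) (λ e → k≢a (cong suc e)) } }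

ordered-tail : ∀ {n} {R : Fin (suc n) → Fin (suc n) → Set} {x : Side} {S : Subset n} →
  Ordered R (x ∷ S) → Ordered (Tail R) S
ordered-tail ord a b a∈S b∈S a<b = ord (suc a) (suc b) (there a∈S) (there b∈S) (s≤s a<b)

ordered-⊆ : ∀ {n} {R : Fin n → Fin n → Set} {S T : Subset n} → Ordered R S → T ⊆ S → Ordered R T
ordered-⊆ ord T⊆S a b a∈T b∈T = ord a b (T⊆S a∈T) (T⊆S b∈T)

pointwise-tail : ∀ {n} {l l′ : List (Fin n)} →
  Pointwise _≤ᶠ_ (map suc l) (map suc l′) → Pointwise _≤ᶠ_ l l′
pointwise-tail p = Pointwise.map ℕ.s≤s⁻¹ (Pointwise.map⁻ suc suc p)

∪-monoˡ : ∀ {n} {S T : Subset n} (C : Subset n) → S ⊆ T → S ∪ C ⊆ T ∪ C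
∪-monoˡ {S = S} {T} C S⊆T x∈S∪C with x∈p∪q⁻ S C x∈S∪C
... | inj₁ x∈S = p⊆p∪q C (S⊆T x∈S)
... | inj₂ x∈C = q⊆p∪q T C x∈C

removeMin : ∀ {n} → Subset n → Subset n
removeMin []            = []
removeMin (inside ∷ S)  = outside ∷ S
removeMin (outside ∷ S) = outside ∷ removeMin S

record RemovesMin {n} (S : Subset n) (a : Fin n) (r : List (Fin n)) : Set where
  field
    a∈S    : Vec.lookup S a ≡ inside
    a∉S′   : Vec.lookup (removeMin S) a ≡ outside
    others : ∀ k → k ≢ a → Vec.lookup (removeMin S) k ≡ Vec.lookup S k
    idx≡   : idx (removeMin S) ≡ r
    ⊆S     : removeMin S ⊆ S

removeMin-spec : ∀ {n} (S : Subset n) a r → idx S ≡ a ∷ r → RemovesMin S a r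
removeMin-spec (inside ∷ S) .zero .(map suc (idx S)) refl = record
  { a∈S = refl ; a∉S′ = refl ; idx≡ = refl
  ; others = λ { zero k≢0 → ⊥-elim (k≢0 refl) ; (suc k) _ → refl }
  ; ⊆S = λ { (there x∈S) → there x∈S } }
removeMin-spec (outside ∷ S) a r eq with idx S in idx-S
removeMin-spec (outside ∷ S) a r () | []
removeMin-spec (outside ∷ S) .(suc a′) .(map suc r′) refl | a′ ∷ r′ = record
  { a∈S = a∈S ; a∉S′ = a∉S′ ; idx≡ = cong (map suc) idx≡
  ; others = λ { zero _ → refl ; (suc k) k≢a → others k (λ e → k≢a (cong suc e)) }
  ; ⊆S = λ { (there x∈S′) → there (⊆S x∈S′) } }
  where open RemovesMin (removeMin-spec S a′ r′ idx-S)

exchanges-to-left : ∀ {n} (R : Fin n → Fin n → Set) (A C : Subset n) →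
  Pointwise _≤ᶠ_ (idx C) (idx A) → Ordered R (A ∪ C) → Exchanges R A C
exchanges-to-left R [] [] _ _ = done
exchanges-to-left R (inside ∷ A) (inside ∷ C) (_ ∷ p) ord =
  exchanges-cons inside (exchanges-to-left _ A C (pointwise-tail p) (ordered-tail ord))
exchanges-to-left R (outside ∷ A) (outside ∷ C) p ord =
  exchanges-cons outside (exchanges-to-left _ A C (pointwise-tail p) (ordered-tail ord))
-- A contains the first vertex but C does not: C cannot be to the left of A.
exchanges-to-left R (inside ∷ A) (outside ∷ C) p ord with idx C
... | []     with p
...   | ()
exchanges-to-left R (inside ∷ A) (outside ∷ C) (() ∷ _) ord | _ ∷ _
-- C contains the first vertex but A does not: exchange the least element a of
-- A for the first vertex, then both sets contain it.
exchanges-to-left R (outside ∷ A) (inside ∷ C) p ord with idx A in idx-A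
... | []     with p
...   | ()
exchanges-to-left R (outside ∷ A) (inside ∷ C) (_ ∷ p) ord | a ∷ r =
  step exchange (ord zero (suc a) here (there (p⊆p∪q C a∈A′)) (s≤s z≤n))
    (exchanges-cons inside (exchanges-to-left _ (removeMin A) C p′ (ordered-tail ord′)))
  where
  open RemovesMin (removeMin-spec A a r idx-A)
  a∈A′ : a ∈ A
  a∈A′ = lookup⇒[]= a A a∈S
  p′ : Pointwise _≤ᶠ_ (idx C) (idx (removeMin A))
  p′ rewrite idx≡ = pointwise-tail p
  ord′ : Ordered R (inside ∷ (removeMin A ∪ C))
  ord′ = ordered-⊆ ord λ { here → here ; (there x∈) → there (∪-monoˡ C ⊆S x∈) }
  exchange : Exchange (outside ∷ A) (inside ∷ removeMin A) zero (suc a)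
  exchange = record
    { c∉A = refl ; a∈A = a∈S ; c∈B = refl ; a∉B = a∉S′
    ; rest = λ { zero k≢0 _ → ⊥-elim (k≢0 refl)
               ; (suc k) _ k≢a → others k (λ e → k≢a (cong suc e)) } }

inDemand : Bool → ℕ → ℤ
inDemand member d = if member then + d ℤ.- + 1 else + d

reducedEntry : ∀ {n} → (Fin (suc n) → ℕ) → (Fin (suc n) → ℕ) → Subset n →
  Fin (suc n) → ℤ × ℤ
reducedEntry d⁺ d⁻ S k = (if isLast k then + 0 else + d⁺ k) , inDemand (memb S k) (d⁻ k)

reduced⇔realizable : ∀ {n} (d⁺ d⁻ : Fin (suc n) → ℕ) (S : Subset n) →
  BiGraphical (reduced d⁺ d⁻ S) ⇔ Realizable (reducedEntry d⁺ d⁻ S)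
reduced⇔realizable {n} d⁺ d⁻ S =
  ⇔.trans (graphical⇔realizable (reduced d⁺ d⁻ S))
    (⇔.trans (⇔.sym (remove-zeros [] (map (reducedEntry d⁺ d⁻ S) (allFin (suc n)))))
             (realizable-tabulate (reducedEntry d⁺ d⁻ S)))

isLast-inject₁ : ∀ {n} (k : Fin n) → isLast (inject₁ k) ≡ false
isLast-inject₁ {suc n} zero    = refl
isLast-inject₁ {suc n} (suc k) = isLast-inject₁ k

memb-suc : ∀ {n} (x : Side) (S : Subset n) k → memb (x ∷ S) (suc k) ≡ memb S k
memb-suc inside  S k = refl
memb-suc outside S k = refl

memb-inject₁ : ∀ {n} (S : Subset n) k → memb S (inject₁ k) ≡ Vec.lookup S k
memb-inject₁ (inside ∷ S)  zero    = refl
memb-inject₁ (outside ∷ S) zero    = refl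
memb-inject₁ (x ∷ S)       (suc k) = trans (memb-suc x S (inject₁ k)) (memb-inject₁ S k)

memb-agree : ∀ {n} (A B : Subset n) k →
  (∀ k′ → k ≡ inject₁ k′ → Vec.lookup B k′ ≡ Vec.lookup A k′) → memb B k ≡ memb A k
memb-agree []      []      zero    _    = refl
memb-agree (x ∷ A) (y ∷ B) zero    same with same zero refl
memb-agree (inside ∷ A)  (.inside ∷ B)  zero _ | refl = refl
memb-agree (outside ∷ A) (.outside ∷ B) zero _ | refl = refl
memb-agree (x ∷ A) (y ∷ B) (suc k) same =
  trans (memb-suc y B k)
    (trans (memb-agree A B k (λ k′ e → same (suc k′) (cong suc e))) (sym (memb-suc x A k)))

Precedes : ∀ {n} → (Fin (suc n) → ℕ) → (Fin (suc n) → ℕ) → Fin n → Fin n → Set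
Precedes d⁺ d⁻ c a = Before (d⁻ (inject₁ c)) (d⁺ (inject₁ c)) (d⁻ (inject₁ a)) (d⁺ (inject₁ a))

exchange-shift : ∀ {n} (d⁺ d⁻ : Fin (suc n) → ℕ) {A B : Subset n} {c a : Fin n} →
  Exchange A B c a →
  DemandShift (reducedEntry d⁺ d⁻ A) (reducedEntry d⁺ d⁻ B) (inject₁ c) (inject₁ a)
exchange-shift d⁺ d⁻ {A} {B} {c} {a} ex = record
  { out-c = d⁺ (inject₁ c) ; in-c = d⁻ (inject₁ c)
  ; out-a = d⁺ (inject₁ a) ; in-a = d⁻ (inject₁ a)
  ; c≢a = c≢a
  ; source-before = entry A c c∉A
  ; source-after  = entry B c c∈B
  ; target-before = entry A a a∈A
  ; target-after  = entry B a a∉B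
  ; elsewhere     = λ k k≢c k≢a → cong (λ b → _ , inDemand b (d⁻ k))
      (memb-agree A B k (λ k′ k≡ → rest k′ (λ { refl → k≢c k≡ }) (λ { refl → k≢a k≡ })))
  }
  where
  open Exchange ex
  entry : ∀ S k {x} → Vec.lookup S k ≡ x →
    reducedEntry d⁺ d⁻ S (inject₁ k) ≡ (+ d⁺ (inject₁ k) , inDemand x (d⁻ (inject₁ k)))
  entry S k refl rewrite isLast-inject₁ k | memb-inject₁ S k = refl
  c≢a : inject₁ c ≢ inject₁ a
  c≢a e with inject₁-injective e
  ... | refl with trans (sym c∉A) a∈A
  ...   | ()

along-exchanges : ∀ {n} (d⁺ d⁻ : Fin (suc n) → ℕ) {A C : Subset n} →
  Exchanges (Precedes d⁺ d⁻) A C →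
  Realizable (reducedEntry d⁺ d⁻ A) → Realizable (reducedEntry d⁺ d⁻ C)
along-exchanges d⁺ d⁻ done                       r = r
along-exchanges d⁺ d⁻ (step ex precedes chain) r =
  along-exchanges d⁺ d⁻ chain (demand-shift (exchange-shift d⁺ d⁻ ex) precedes r)

-- Lemma 2.
lemma2 : (n : ℕ) (d⁺ d⁻ : Fin (suc n) → ℕ) (A C : Subset n) →
         ∣ A ∣ ≡ d⁺ (fromℕ n) → ∣ C ∣ ≡ d⁺ (fromℕ n) →
         LeftOf C A → NormalOrder d⁺ d⁻ (A ∪ C) →
         BiGraphical (reduced d⁺ d⁻ A) → BiGraphical (reduced d⁺ d⁻ C)
lemma2 n d⁺ d⁻ A C _ _ (_ , C-left-of-A) normal graphical-A =
  Equivalence.from (reduced⇔realizable d⁺ d⁻ C)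
    (along-exchanges d⁺ d⁻ (exchanges-to-left (Precedes d⁺ d⁻) A C C-left-of-A normal)
      (Equivalence.to (reduced⇔realizable d⁺ d⁻ A) graphical-A))
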